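{- Let $n$ and $k$ be positive integers and let $D$ be the transitive orientation of the complete graph $K_n$. Then \[F_k(D) = \Big\lceil \frac{n}{k+1} \Big\rceil.\]
   Context: An orientation of a simple graph $G$ assigns to each edge $\{u,v\}$ exactly one of the arcs $(u,v)$ or $(v,u)$; if $(u,v)$ is an arc, $v$ is an out-neighbor of $u$. The transitive orientation of $K_n$ with vertices $v_1,\dots,v_n$ is the orientation in which $v_i$ is directed towards $v_j$ if and only if $i<j$. Oriented $k$-forcing: given an orientation $D$ and a set $S$ of initially colored vertices (all others non-colored), the $k$-color change rule says that any colored vertex having at most $k$ non-colored out-neighbors forces all of these out-neighbors to become colored; this rule is applied iteratively (all forcings in a step happen simultaneously) as long as possible. $S$ is an oriented $k$-forcing set of $D$ if at the end every vertex is colored. $F_k(D)$ denotes the minimum cardinality of an oriented $k$-forcing set of $D$. -}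

module Defs where

open import Data.Nat using (ℕ; zero; suc; _+_; _≤_; _≤ᵇ_; _<ᵇ_; _/_)
open import Data.Bool using (Bool; true; false; _∧_; _∨_; not; if_then_else_)
open import Data.Fin using (Fin; toℕ)
open import Data.Fin.Subset using (Subset; ⊤; ∣_∣)
open import Data.Vec using (Vec; tabulate; lookup; foldr)
open import Data.Product using (Σ; ∃; _×_)
open import Relation.Binary.PropositionalEquality using (_≡_)

-- A digraph (in particular an orientation of a simple graph) on the vertex
-- set Fin n, given by its (Boolean) arc relation: arc u v = true iff (u,v) is an arc.
Digraph : ℕ → Set
Digraph n = Fin n → Fin n → Bool

transitiveTournament : (n : ℕ) → Digraph n
transitiveTournament n i j = toℕ i <ᵇ toℕ j

countTrue : ∀ {n} → Vec Bool n → ℕ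
countTrue = foldr _ (λ b c → if b then suc c else c) 0

anyFin : ∀ {n} → (Fin n → Bool) → Bool
anyFin p = foldr _ _∨_ false (tabulate p)

nonColoredOut : ∀ {n} → Digraph n → Subset n → Fin n → ℕ
nonColoredOut D C u = countTrue (tabulate (λ v → D u v ∧ not (lookup C v)))

canForce : ∀ {n} → ℕ → Digraph n → Subset n → Fin n → Bool
canForce k D C u = lookup C u ∧ (nonColoredOut D C u ≤ᵇ k)

forceStep : ∀ {n} → ℕ → Digraph n → Subset n → Subset n
forceStep k D C = tabulate (λ v → lookup C v ∨ anyFin (λ u → canForce k D C u ∧ D u v))

forceIter : ∀ {n} → ℕ → Digraph n → ℕ → Subset n → Subset n
forceIter k D zero    C = C
forceIter k D (suc t) C = forceStep k D (forceIter k D t C)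

IsKForcingSet : ∀ {n} → ℕ → Digraph n → Subset n → Set
IsKForcingSet k D S = ∃ λ t → forceIter k D t S ≡ ⊤

IsFk : ∀ {n} → ℕ → Digraph n → ℕ → Set
IsFk k D m =
  (Σ _ λ S → IsKForcingSet k D S × ∣ S ∣ ≡ m) ×
  (∀ S → IsKForcingSet k D S → m ≤ ∣ S ∣)

⌈_/suc_⌉ : ℕ → ℕ → ℕ
⌈ a /suc c ⌉ = (a + c) / suc c

module Submission where

-- In the transitive tournament on Fin n, vertex 0 is a source whose out-neighbourhood
-- is every other vertex, and the remaining vertices again form a transitive
-- tournament.  So one step of the k-color change rule acts on a colouring c ∷ C as
-- `step`: vertex 0 keeps its colour; if it is colored and C has at most k holes
-- (non-colored vertices) it fires and colours everything, otherwise C evolves alone.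
--
-- Lower bound: the potential Φ, charging a colored vertex 1 if no hole follows it and
-- k+1 otherwise, never increases under `step`, is at most (k+1)·|C|, and equals n on
-- the full colouring.  Hence every k-forcing set S has n ≤ (k+1)·|S|, i.e.
-- ⌈n/(k+1)⌉ ≤ |S|.
-- Upper bound: colouring the vertices 0, k+1, 2(k+1), … (`spaced 0`) uses
-- ⌈n/(k+1)⌉ vertices, and by induction from the back each colored vertex eventually
-- sees at most k holes after it and fires, so the whole tournament gets colored.

open import Defs
open import Data.Nat using (ℕ; zero; suc; _+_; _*_; _≤_; _<_; _≤ᵇ_; _/_; z≤n; s≤s; NonZero)
open import Data.Nat.Properties
open import Data.Nat.DivMod using (m<n*o⇒m/o<n; m/n≡1+[m∸n]/n; m<n⇒m/n≡0; /-congˡ)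
open import Data.Bool using (Bool; true; false; _∧_; _∨_; not; if_then_else_; T)
open import Data.Bool.Properties using (∨-identityʳ; ∨-zeroʳ; ∧-zeroʳ)
open import Data.Fin using (Fin) renaming (zero to fzero; suc to fsuc)
open import Data.Fin.Subset using (Subset; ⊤; ∣_∣)
open import Data.Vec using ([]; _∷_; tabulate; lookup)
open import Data.Vec.Properties using (tabulate-cong)
open import Data.Product using (∃; _,_)
open import Data.Sum using (_⊎_; inj₁; inj₂)
open import Relation.Nullary using (yes; no)
open import Relation.Binary.PropositionalEquality

[m+n]/n≡1+m/n : ∀ m n .{{_ : NonZero n}} → (m + n) / n ≡ suc (m / n)
[m+n]/n≡1+m/n m n = trans (m/n≡1+[m∸n]/n (m≤n+m n m)) (cong (λ x → suc (x / n)) (m+n∸n≡m m n))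

⌈/suc⌉-least : ∀ n k s → n ≤ suc k * s → ⌈ n /suc k ⌉ ≤ s
⌈/suc⌉-least n k s n≤ = ≤-pred (m<n*o⇒m/o<n {n + k} {suc s} {suc k} n+k<)
  where
  open ≤-Reasoning
  n+k< : n + k < suc s * suc k
  n+k< = begin-strict
    n + k             <⟨ ≤-reflexive (sym (+-suc n k)) ⟩
    n + suc k         ≤⟨ +-monoˡ-≤ (suc k) n≤ ⟩
    suc k * s + suc k ≡⟨ +-comm (suc k * s) (suc k) ⟩
    suc k + suc k * s ≡⟨ *-suc (suc k) s ⟨
    suc k * suc s     ≡⟨ *-comm (suc k) (suc s) ⟩
    suc s * suc k     ∎

holes : ∀ {n} → Subset n → ℕ
holes C = countTrue (tabulate (λ v → not (lookup C v)))

holes-⊤ : ∀ n → holes (⊤ {n}) ≡ 0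
holes-⊤ zero    = refl
holes-⊤ (suc n) = holes-⊤ n

holes≡0⇒⊤ : ∀ {n} (C : Subset n) → holes C ≡ 0 → C ≡ ⊤
holes≡0⇒⊤ []          _  = refl
holes≡0⇒⊤ (true ∷ C)  h0 = cong (true ∷_) (holes≡0⇒⊤ C h0)
holes≡0⇒⊤ (false ∷ C) ()

∣C∣+holes≡n : ∀ {n} (C : Subset n) → ∣ C ∣ + holes C ≡ n
∣C∣+holes≡n []          = refl
∣C∣+holes≡n (true ∷ C)  = cong suc (∣C∣+holes≡n C)
∣C∣+holes≡n (false ∷ C) = trans (+-suc ∣ C ∣ (holes C)) (cong suc (∣C∣+holes≡n C))

tabulate-true : ∀ n → tabulate {n = n} (λ _ → true) ≡ ⊤
tabulate-true zero    = refl
tabulate-true (suc n) = cong (true ∷_) (tabulate-true n)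

anyFin-false : ∀ {n} (p : Fin n → Bool) → (∀ u → p u ≡ false) → anyFin p ≡ false
anyFin-false {zero}  p _     = refl
anyFin-false {suc n} p false! rewrite false! fzero = anyFin-false (λ u → p (fsuc u)) (λ u → false! (fsuc u))

module OnTransitiveTournament (k : ℕ) where

  step : ∀ {n} → Subset n → Subset n
  step []      = []
  step (c ∷ C) = c ∷ (if c ∧ (holes C ≤ᵇ k) then ⊤ else step C)

  -- The source keeps its colour (no in-arcs); its firing colours all later vertices,
  -- and otherwise only the later vertices force each other.
  forceStep≡step : ∀ {n} (C : Subset n) → forceStep k (transitiveTournament n) C ≡ step C
  forceStep≡step []            = refl
  forceStep≡step {suc n} (c ∷ C) = cong₂ _∷_ source-keeps (later (c ∧ (holes C ≤ᵇ k)))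
    where
    D : Digraph n
    D = transitiveTournament n
    forces : Fin (suc n) → Bool
    forces = canForce k (transitiveTournament (suc n)) (c ∷ C)
    source-keeps : c ∨ anyFin (λ u → forces u ∧ false) ≡ c
    source-keeps = trans (cong (c ∨_) (anyFin-false _ (λ u → ∧-zeroʳ (forces u)))) (∨-identityʳ c)
    later : ∀ fires → tabulate (λ v → lookup C v ∨ ((fires ∧ true) ∨ anyFin (λ u → canForce k D C u ∧ D u v)))
                      ≡ (if fires then ⊤ else step C)
    later false = forceStep≡step C
    later true  = trans (tabulate-cong (λ v → ∨-zeroʳ (lookup C v))) (tabulate-true n)

  steps : ∀ {n} → ℕ → Subset n → Subset n
  steps zero    C = C
  steps (suc t) C = step (steps t C)

  forceIter≡steps : ∀ {n} t (C : Subset n) → forceIter k (transitiveTournament n) t C ≡ steps t C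
  forceIter≡steps zero    C = refl
  forceIter≡steps (suc t) C = trans (cong (forceStep k _) (forceIter≡steps t C)) (forceStep≡step (steps t C))

  step-⊤ : ∀ n → step (⊤ {n}) ≡ ⊤
  step-⊤ zero    = refl
  step-⊤ (suc n) rewrite holes-⊤ n = refl

  -- Forcing never uncolours a vertex, so the number of holes does not grow.
  holes-step : ∀ {n} (C : Subset n) → holes (step C) ≤ holes C
  holes-step []          = z≤n
  holes-step (false ∷ C) = s≤s (holes-step C)
  holes-step {suc n} (true ∷ C) with holes C ≤ᵇ k
  ... | true  = subst (_≤ holes C) (sym (holes-⊤ n)) z≤n
  ... | false = holes-step C

  -- Lower bound.  The charge of a colored vertex followed by z holes.
  weight : ℕ → ℕ
  weight zero    = 1
  weight (suc _) = suc k

  weight-mono : ∀ {y z} → y ≤ z → weight y ≤ weight z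
  weight-mono {zero}  {zero}  _ = ≤-refl
  weight-mono {zero}  {suc _} _ = s≤s z≤n
  weight-mono {suc _} {suc _} _ = ≤-refl

  weight≤1+k : ∀ z → weight z ≤ suc k
  weight≤1+k zero    = s≤s z≤n
  weight≤1+k (suc _) = ≤-refl

  weight-covers : ∀ z → z ≤ k → 0 < z → suc z ≤ weight z
  weight-covers (suc z) z≤k _ = s≤s z≤k

  Φ : ∀ {n} → Subset n → ℕ
  Φ []      = 0
  Φ (c ∷ C) = (if c then weight (holes C) else 0) + Φ C

  Φ-⊤ : ∀ n → Φ (⊤ {n}) ≡ n
  Φ-⊤ zero    = refl
  Φ-⊤ (suc n) rewrite holes-⊤ n = cong suc (Φ-⊤ n)

  ∣C∣≤Φ : ∀ {n} (C : Subset n) → ∣ C ∣ ≤ Φ C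
  ∣C∣≤Φ []          = z≤n
  ∣C∣≤Φ (false ∷ C) = ∣C∣≤Φ C
  ∣C∣≤Φ (true ∷ C)  = +-mono-≤ (weight-mono {0} z≤n) (∣C∣≤Φ C)

  Φ≤ : ∀ {n} (C : Subset n) → Φ C ≤ suc k * ∣ C ∣
  Φ≤ []          = z≤n
  Φ≤ (false ∷ C) = Φ≤ C
  Φ≤ (true ∷ C)  = ≤-trans (+-mono-≤ (weight≤1+k (holes C)) (Φ≤ C))
                           (≤-reflexive (sym (*-suc (suc k) ∣ C ∣)))

  n≤holes+Φ : ∀ {n} (C : Subset n) → n ≤ holes C + Φ C
  n≤holes+Φ C = ≤-trans (≤-reflexive (trans (sym (∣C∣+holes≡n C)) (+-comm ∣ C ∣ (holes C))))
                        (+-monoʳ-≤ (holes C) (∣C∣≤Φ C))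

  -- When a colored source fires, the potential it had already pays for the full colouring.
  firing-bound : ∀ {n} (C : Subset n) → holes C ≤ k → suc n ≤ weight (holes C) + Φ C
  firing-bound {n} C h≤k with holes C ≟ 0
  ... | yes h≡0 rewrite holes≡0⇒⊤ C h≡0 | holes-⊤ n | Φ-⊤ n = ≤-refl
  ... | no  h≢0 = ≤-trans (s≤s (n≤holes+Φ C))
                          (+-monoˡ-≤ (Φ C) (weight-covers (holes C) h≤k (n≢0⇒n>0 h≢0)))

  Φ-step : ∀ {n} (C : Subset n) → Φ (step C) ≤ Φ C
  Φ-step []          = z≤n
  Φ-step (false ∷ C) = Φ-step C
  Φ-step {suc n} (true ∷ C) with holes C ≤ᵇ k in fires
  ... | false = +-mono-≤ (weight-mono (holes-step C)) (Φ-step C)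
  ... | true rewrite holes-⊤ n | Φ-⊤ n =
    firing-bound C (≤ᵇ⇒≤ (holes C) k (subst T (sym fires) _))

  Φ-steps : ∀ {n} t (C : Subset n) → Φ (steps t C) ≤ Φ C
  Φ-steps zero    C = ≤-refl
  Φ-steps (suc t) C = ≤-trans (Φ-step (steps t C)) (Φ-steps t C)

  forcing-set-size : ∀ {n} (S : Subset n) → IsKForcingSet k (transitiveTournament n) S →
                     n ≤ suc k * ∣ S ∣
  forcing-set-size {n} S (t , colours-all) = begin
    n                                            ≡⟨ sym (Φ-⊤ n) ⟩
    Φ (⊤ {n})                                    ≡⟨ cong Φ (sym colours-all) ⟩
    Φ (forceIter k (transitiveTournament n) t S) ≡⟨ cong Φ (forceIter≡steps t S) ⟩
    Φ (steps t S)                                ≤⟨ Φ-steps t S ⟩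
    Φ S                                          ≤⟨ Φ≤ S ⟩
    suc k * ∣ S ∣                                ∎
    where open ≤-Reasoning

  -- Upper bound.  Leave j vertices uncolored, colour the next one, and repeat with gaps of k.
  spaced : ℕ → (n : ℕ) → Subset n
  spaced _       zero    = []
  spaced zero    (suc n) = true ∷ spaced k n
  spaced (suc j) (suc n) = false ∷ spaced j n

  -- With j + r = k, the spaced colouring colours ⌈(n - j)/(k+1)⌉ = (n + r)/(k+1) vertices.
  ∣spaced∣ : ∀ j r n → j + r ≡ k → ∣ spaced j n ∣ ≡ (n + r) / suc k
  ∣spaced∣ j r zero j+r≡k = sym (m<n⇒m/n≡0 (s≤s (subst (r ≤_) j+r≡k (m≤n+m r j))))
  ∣spaced∣ zero .k (suc n) refl = begin
    suc ∣ spaced k n ∣      ≡⟨ cong suc (∣spaced∣ k 0 n (+-identityʳ k)) ⟩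
    suc ((n + 0) / suc k)   ≡⟨ cong (λ m → suc (m / suc k)) (+-identityʳ n) ⟩
    suc (n / suc k)         ≡⟨ sym ([m+n]/n≡1+m/n n (suc k)) ⟩
    (n + suc k) / suc k     ≡⟨ /-congˡ (+-suc n k) ⟩
    (suc n + k) / suc k     ∎
    where open ≡-Reasoning
  ∣spaced∣ (suc j) r (suc n) j+r≡k =
    trans (∣spaced∣ j (suc r) n (trans (+-suc j r) j+r≡k)) (/-congˡ (+-suc n r))

  steps-uncolored-source : ∀ {n} t (C : Subset n) → steps t (false ∷ C) ≡ false ∷ steps t C
  steps-uncolored-source zero    C = refl
  steps-uncolored-source (suc t) C rewrite steps-uncolored-source t C = refl

  steps-colored-source : ∀ {n} t (C : Subset n) →
                         steps t (true ∷ C) ≡ true ∷ steps t C ⊎ steps t (true ∷ C) ≡ ⊤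
  steps-colored-source zero C = inj₁ refl
  steps-colored-source {n} (suc t) C with steps-colored-source t C
  ... | inj₂ full rewrite full = inj₂ (step-⊤ (suc n))
  ... | inj₁ alone rewrite alone with holes (steps t C) ≤ᵇ k
  ...   | true  = inj₂ refl
  ...   | false = inj₁ refl

  source-fires : ∀ {n} t (C : Subset n) → holes (steps t C) ≤ k → steps (suc t) (true ∷ C) ≡ ⊤
  source-fires {n} t C few with steps-colored-source t C
  ... | inj₂ full rewrite full = step-⊤ (suc n)
  ... | inj₁ alone rewrite alone with holes (steps t C) ≤ᵇ k | ≤⇒≤ᵇ few
  ...   | true | _ = refl

  spaced-forces : ∀ j n → ∃ λ t → holes (steps t (spaced j n)) ≤ j
  spaced-forces j zero = 0 , z≤n
  spaced-forces zero (suc n) with spaced-forces k n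
  ... | t , few = suc t , ≤-reflexive (trans (cong holes (source-fires t (spaced k n) few)) (holes-⊤ (suc n)))
  spaced-forces (suc j) (suc n) with spaced-forces j n
  ... | t , few = t , subst (λ C → holes C ≤ suc j) (sym (steps-uncolored-source t (spaced j n))) (s≤s few)

  spaced-isForcing : ∀ n → IsKForcingSet k (transitiveTournament n) (spaced 0 n)
  spaced-isForcing n with spaced-forces 0 n
  ... | t , no-holes = t , trans (forceIter≡steps t (spaced 0 n))
                                 (holes≡0⇒⊤ (steps t (spaced 0 n)) (n≤0⇒n≡0 no-holes))

proposition1 : (n k : ℕ) → 1 ≤ n → 1 ≤ k →
    IsFk k (transitiveTournament n) (⌈ n /suc k ⌉)
proposition1 n k _ _ = (spaced 0 n , spaced-isForcing n , ∣spaced∣ 0 k n refl) , minimal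
  where
  open OnTransitiveTournament k
  minimal : ∀ S → IsKForcingSet k (transitiveTournament n) S → ⌈ n /suc k ⌉ ≤ ∣ S ∣
  minimal S forcing = ⌈/suc⌉-least n k ∣ S ∣ (forcing-set-size S forcing)
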